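{- Let $\mathcal{H}=(V,H)$ be a simplicial complex. Then $J(H\cup\{V\}) = H^{\mathrm{up}}$; that is, a subset $X\subseteq V$ belongs to $H^{\mathrm{up}}$ if and only if $X$ is a transversal of the successive differences of some chain in the Moore family $H\cup\{V\}$. Equivalently, the boolean matrix $M(H\cup\{V\})$ is a boolean matrix representation of $\mathcal{H}^{\mathrm{up}}=(V,H^{\mathrm{up}})$.
   Context: A simplicial complex is a pair $(V,H)$ where $V$ is a finite nonempty set and $H\subseteq 2^V$ contains every singleton $\{v\}$ ($v\in V$) and is closed under taking subsets. Define $H^{\mathrm{up}} = H\cup\{I\cup\{p\} : I\in H,\ p\in V\setminus I\}$ and $\mathcal{H}^{\mathrm{up}}=(V,H^{\mathrm{up}})$. Since $H$ is closed under intersection, $H\cup\{V\}$ is a Moore family (contains $V$, closed under intersection). Given a chain $F_0\subset F_1\subset\cdots\subset F_k$ of subsets of $V$, a transversal of its successive differences is a set $\{x_1,\dots,x_k\}$ with $x_i\in F_i\setminus F_{i-1}$ for all $i$. For a Moore family $R\subseteq 2^V$, $J(R)$ denotes the set of all transversals of successive differences of chains in $R$. For such $R$, $M(R)$ is the $R\times V$ boolean matrix with entry $0$ at $(r,v)$ if $v\in r$ and $1$ otherwise; the simplicial complex represented by $M(R)$ is $(V,J(R))$. -}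

module Defs where

open import Data.Nat using (ℕ; suc)
open import Data.Fin using (Fin)
open import Data.Fin.Subset using (Subset; _∈_; _∉_; _⊆_; _⊂_; _∪_; ⁅_⁆; ⊤)
open import Data.List using (List; []; _∷_)
open import Data.List.Relation.Unary.All using (All)
import Data.List.Membership.Propositional as LM
open import Data.Product using (Σ; _×_; ∃)
open import Data.Sum using (_⊎_)
open import Relation.Binary.PropositionalEquality using (_≡_)
open import Function.Bundles using (_⇔_)

Family : ℕ → Set₁
Family n = Subset n → Set

record IsSimplicialComplex {n : ℕ} (H : Family n) : Set where
  field
    singletons : ∀ (v : Fin n) → H ⁅ v ⁆
    downClosed : ∀ (X Y : Subset n) → X ⊆ Y → H Y → H X

Up : {n : ℕ} → Family n → Family n
Up {n} H X = H X ⊎ Σ (Subset n) (λ I → Σ (Fin n) (λ p → H I × p ∉ I × X ≡ I ∪ ⁅ p ⁆))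

AddTop : {n : ℕ} → Family n → Family n
AddTop H S = H S ⊎ S ≡ ⊤

data StrictChain {n : ℕ} : Subset n → List (Subset n) → Set where
  single : ∀ {F₀} → StrictChain F₀ []
  step   : ∀ {F₀ F₁ Fs} → F₀ ⊂ F₁ → StrictChain F₁ Fs → StrictChain F₀ (F₁ ∷ Fs)

data TransversalList {n : ℕ} : Subset n → List (Subset n) → List (Fin n) → Set where
  done : ∀ {F₀} → TransversalList F₀ [] []
  pick : ∀ {F₀ F₁ Fs x xs} → x ∈ F₁ → x ∉ F₀ → TransversalList F₁ Fs xs →
         TransversalList F₀ (F₁ ∷ Fs) (x ∷ xs)

J : {n : ℕ} → Family n → Family n
J {n} R X =
  Σ (Subset n) λ F₀ → Σ (List (Subset n)) λ Fs → Σ (List (Fin n)) λ xs →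
    All R (F₀ ∷ Fs) × StrictChain F₀ Fs × TransversalList F₀ Fs xs ×
    (∀ (v : Fin n) → (v ∈ X) ⇔ (v LM.∈ xs))

-- Every set of a strict chain in H ∪ {V} except possibly the last one is a face, and the
-- transversal elements lie in the last set. So a transversal lies in a face G, or, when the
-- chain ends in V, in the penultimate face G together with one last element p ∉ G; in either
-- case it belongs to H^up. Conversely, a face Y is a transversal of the chain that adds its
-- elements one at a time, ∅ ⊂ {y₁} ⊂ {y₁,y₂} ⊂ … ⊂ Y, and I ∪ {p} is obtained by closing
-- that chain for I with the step I ⊂ V, choosing p.
module Submission where

open import Defs
open import Data.Nat using (ℕ; suc)
open import Data.Fin using (Fin; zero)
open import Data.Fin.Subset using (Subset; _∈_; _∉_; _⊆_; _⊂_; _∪_; _∩_; ⁅_⁆; ⊤; ⊥)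
open import Data.Fin.Subset.Properties
  using (_∈?_; ∈⊤; ∉⊥; ⊥⊆; ⊆-antisym; x∈⁅x⁆; x∈⁅y⁆⇒x≡y; p⊆p∪q; x∈p∪q⁺; x∈p∪q⁻;
         x∈p∩q⁺; x∈p∩q⁻; p∩q⊆q)
open import Data.List using (List; []; _∷_; _++_; filter; allFin)
open import Data.List.Properties using (++-identityʳ)
open import Data.List.Relation.Unary.All using (All; []; _∷_)
open import Data.List.Relation.Unary.All.Properties using (All¬⇒¬Any)
open import Data.List.Relation.Unary.Any using (here; there)
open import Data.List.Relation.Unary.AllPairs using (_∷_)
open import Data.List.Relation.Unary.Unique.Propositional using (Unique)
open import Data.List.Relation.Unary.Unique.Propositional.Properties using (filter⁺; allFin⁺)
import Data.List.Membership.Propositional as List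
open import Data.List.Membership.Propositional.Properties
  using (∈-filter⁺; ∈-filter⁻; ∈-allFin; ∈-++⁺ˡ; ∈-++⁺ʳ; ∈-++⁻)
open import Data.Product using (Σ; _×_; _,_; proj₁; proj₂)
open import Data.Sum using (_⊎_; inj₁; inj₂; [_,_])
open import Data.Empty using (⊥-elim)
open import Relation.Binary.PropositionalEquality using (_≡_; refl; sym; subst)
open import Function using (_∘_; id; case_of_)
open import Function.Bundles using (_⇔_; mk⇔; Equivalence)

private
  variable
    n : ℕ
    x y : Fin n
    p G X Y B F₀ : Subset n
    xs ys zs : List (Fin n)

x∈p∪⁅y⁆⁻ : ∀ (p : Subset n) y → x ∈ p ∪ ⁅ y ⁆ → x ∈ p ⊎ x ≡ y
x∈p∪⁅y⁆⁻ p y x∈ = [ inj₁ , inj₂ ∘ x∈⁅y⁆⇒x≡y y ] (x∈p∪q⁻ p ⁅ y ⁆ x∈)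

y∈p∪⁅y⁆ : ∀ (p : Subset n) y → y ∈ p ∪ ⁅ y ⁆
y∈p∪⁅y⁆ p y = x∈p∪q⁺ (inj₂ (x∈⁅x⁆ y))

x∉p⇒p⊂p∪⁅x⁆ : x ∉ p → p ⊂ p ∪ ⁅ x ⁆
x∉p⇒p⊂p∪⁅x⁆ {x = x} {p = p} x∉p = p⊆p∪q ⁅ x ⁆ , x , y∈p∪⁅y⁆ p x , x∉p

X⊆G∪⁅p⁆⇒X≡X∩G∪⁅p⁆ : ∀ {p} → X ⊆ G ∪ ⁅ p ⁆ → p ∈ X → X ≡ (X ∩ G) ∪ ⁅ p ⁆
X⊆G∪⁅p⁆⇒X≡X∩G∪⁅p⁆ {X = X} {G = G} {p = p} X⊆ p∈X = ⊆-antisym ⊆∪ ∪⊆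
  where
  ⊆∪ : X ⊆ (X ∩ G) ∪ ⁅ p ⁆
  ⊆∪ v∈X with x∈p∪⁅y⁆⁻ G p (X⊆ v∈X)
  ... | inj₁ v∈G = x∈p∪q⁺ (inj₁ (x∈p∩q⁺ (v∈X , v∈G)))
  ... | inj₂ refl = y∈p∪⁅y⁆ (X ∩ G) p
  ∪⊆ : (X ∩ G) ∪ ⁅ p ⁆ ⊆ X
  ∪⊆ v∈ with x∈p∪⁅y⁆⁻ (X ∩ G) p v∈
  ... | inj₁ v∈X∩G = proj₁ (x∈p∩q⁻ X G v∈X∩G)
  ... | inj₂ refl = p∈X

Enumerates : List (Fin n) → Subset n → Set
Enumerates xs X = ∀ v → v ∈ X ⇔ v List.∈ xs

elements : Subset n → List (Fin n)
elements {n} X = filter (_∈? X) (allFin n)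

elements-unique : (X : Subset n) → Unique (elements X)
elements-unique {n} X = filter⁺ (_∈? X) (allFin⁺ n)

elements-enumerates : (X : Subset n) → Enumerates (elements X) X
elements-enumerates {n} X v =
  mk⇔ (∈-filter⁺ (_∈? X) (∈-allFin v)) (proj₂ ∘ ∈-filter⁻ (_∈? X) {xs = allFin n})

enumerates-∪⁅⁆ : Enumerates xs X → Enumerates (xs ++ y ∷ []) (X ∪ ⁅ y ⁆)
enumerates-∪⁅⁆ {xs = xs} {X = X} {y = y} enum v = mk⇔ to from
  where
  to : v ∈ X ∪ ⁅ y ⁆ → v List.∈ xs ++ y ∷ []
  to v∈ with x∈p∪⁅y⁆⁻ X y v∈
  ... | inj₁ v∈X = ∈-++⁺ˡ (Equivalence.to (enum v) v∈X)
  ... | inj₂ refl = ∈-++⁺ʳ xs (here refl)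
  from : v List.∈ xs ++ y ∷ [] → v ∈ X ∪ ⁅ y ⁆
  from v∈ with ∈-++⁻ xs v∈
  ... | inj₁ v∈xs = x∈p∪q⁺ (inj₁ (Equivalence.from (enum v) v∈xs))
  ... | inj₂ (here refl) = y∈p∪⁅y⁆ X y

ChainWithTransversal : Family n → Subset n → List (Fin n) → Set
ChainWithTransversal {n} R F₀ xs = Σ (List (Subset n)) λ Fs →
  All R (F₀ ∷ Fs) × StrictChain F₀ Fs × TransversalList F₀ Fs xs

chain⇒J : {R : Family n} → ChainWithTransversal R F₀ xs → Enumerates xs X → J R X
chain⇒J (Fs , inR , strict , transversal) enum = _ , Fs , _ , inR , strict , transversal , enum

prepend-elements : {R : Family n} → Unique ys → (∀ {S} → S ⊆ Y → R S) →
  (∀ v → v ∈ Y ⇔ (v ∈ B ⊎ v List.∈ ys)) → (∀ {y} → y List.∈ ys → y ∉ B) →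
  ChainWithTransversal R Y zs → ChainWithTransversal R B (ys ++ zs)
prepend-elements {ys = []} _ _ split _ chain
  with ⊆-antisym (λ {v} v∈Y → [ id , (λ ()) ] (Equivalence.to (split v) v∈Y))
                 (λ {v} v∈B → Equivalence.from (split v) (inj₁ v∈B))
... | refl = chain
prepend-elements {ys = y ∷ ys} {Y = Y} {B = B} (y∉ys ∷ unique) below split disjoint chain
  with prepend-elements unique below split′ disjoint′ chain
  where
  split′ : ∀ v → v ∈ Y ⇔ (v ∈ B ∪ ⁅ y ⁆ ⊎ v List.∈ ys)
  split′ v = mk⇔ to from
    where
    to : v ∈ Y → v ∈ B ∪ ⁅ y ⁆ ⊎ v List.∈ ys
    to v∈Y with Equivalence.to (split v) v∈Y
    ... | inj₁ v∈B = inj₁ (x∈p∪q⁺ (inj₁ v∈B))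
    ... | inj₂ (here refl) = inj₁ (y∈p∪⁅y⁆ B y)
    ... | inj₂ (there v∈ys) = inj₂ v∈ys
    from : v ∈ B ∪ ⁅ y ⁆ ⊎ v List.∈ ys → v ∈ Y
    from (inj₁ v∈) with x∈p∪⁅y⁆⁻ B y v∈
    ... | inj₁ v∈B = Equivalence.from (split v) (inj₁ v∈B)
    ... | inj₂ refl = Equivalence.from (split v) (inj₂ (here refl))
    from (inj₂ v∈ys) = Equivalence.from (split v) (inj₂ (there v∈ys))
  disjoint′ : ∀ {z} → z List.∈ ys → z ∉ B ∪ ⁅ y ⁆
  disjoint′ z∈ys z∈ with x∈p∪⁅y⁆⁻ B y z∈
  ... | inj₁ z∈B = disjoint (there z∈ys) z∈B
  ... | inj₂ refl = All¬⇒¬Any y∉ys z∈ys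
... | Fs , inR , strict , transversal =
  B ∪ ⁅ y ⁆ ∷ Fs ,
  below (λ {v} v∈B → Equivalence.from (split v) (inj₁ v∈B)) ∷ inR ,
  step (x∉p⇒p⊂p∪⁅x⁆ (disjoint (here refl))) strict ,
  pick (y∈p∪⁅y⁆ B y) (disjoint (here refl)) transversal

elements-chain : {R : Family n} → (∀ {S} → S ⊆ Y → R S) →
  ChainWithTransversal R Y zs → ChainWithTransversal R ⊥ (elements Y ++ zs)
elements-chain {Y = Y} below =
  prepend-elements (elements-unique Y) below split (λ _ → ∉⊥)
  where
  split : ∀ v → v ∈ Y ⇔ (v ∈ ⊥ ⊎ v List.∈ elements Y)
  split v = mk⇔ (inj₂ ∘ Equivalence.to (elements-enumerates Y v))
                [ ⊥-elim ∘ ∉⊥ , Equivalence.from (elements-enumerates Y v) ]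

-- Keeping F₀ ⊆ G lets the description pass from a chain to one extended below F₀.
data TransversalShape (H : Family n) (F₀ : Subset n) (xs : List (Fin n)) : Set where
  empty-at-top : F₀ ≡ ⊤ → xs ≡ [] → TransversalShape H F₀ xs
  within-face : H G → F₀ ⊆ G → (∀ {x} → x List.∈ xs → x ∈ G) → TransversalShape H F₀ xs
  within-face-∪⁅⁆ : ∀ {G} p → H G → F₀ ⊆ G → p ∉ G → p List.∈ xs →
    (∀ {x} → x List.∈ xs → x ∈ G ∪ ⁅ p ⁆) → TransversalShape H F₀ xs

transversal-shape : {H : Family n} →
  ChainWithTransversal (AddTop H) F₀ xs → TransversalShape H F₀ xs
transversal-shape ([] , inj₁ hF₀ ∷ [] , single , done) = within-face hF₀ id (λ ())
transversal-shape ([] , inj₂ F₀≡⊤ ∷ [] , single , done) = empty-at-top F₀≡⊤ refl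
transversal-shape {F₀ = F₀}
  (F₁ ∷ Fs , a ∷ inR , step (F₀⊆F₁ , _) strict , pick {x = x} x∈F₁ x∉F₀ transversal)
  with transversal-shape (Fs , inR , strict , transversal) | a
... | empty-at-top refl refl | inj₁ hF₀ =
  within-face-∪⁅⁆ x hF₀ id x∉F₀ (here refl) λ { (here refl) → y∈p∪⁅y⁆ F₀ x }
-- V has no strict superset, so it can only be the last set of the chain.
... | empty-at-top refl refl | inj₂ refl = ⊥-elim (x∉F₀ ∈⊤)
... | within-face hG F₁⊆G xs⊆G | _ =
  within-face hG (F₁⊆G ∘ F₀⊆F₁) λ { (here refl) → F₁⊆G x∈F₁ ; (there x∈xs) → xs⊆G x∈xs }
... | within-face-∪⁅⁆ p hG F₁⊆G p∉G p∈xs xs⊆G∪p | _ =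
  within-face-∪⁅⁆ p hG (F₁⊆G ∘ F₀⊆F₁) p∉G (there p∈xs)
    λ { (here refl) → p⊆p∪q ⁅ p ⁆ (F₁⊆G x∈F₁) ; (there x∈xs) → xs⊆G∪p x∈xs }

module _ {m : ℕ} {H : Family (suc m)} (complex : IsSimplicialComplex H) where
  open IsSimplicialComplex complex

  empty-face : H ⊥
  empty-face = downClosed ⊥ ⁅ zero ⁆ ⊥⊆ (singletons zero)

  shape⇒Up : TransversalShape H F₀ xs → Enumerates xs X → Up H X
  shape⇒Up {X = X} (empty-at-top _ refl) enum =
    inj₁ (downClosed X ⊥ (λ {v} v∈X → case Equivalence.to (enum v) v∈X of λ ()) empty-face)
  shape⇒Up {X = X} (within-face {G = G} hG _ xs⊆G) enum =
    inj₁ (downClosed X G (λ {v} → xs⊆G ∘ Equivalence.to (enum v)) hG)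
  shape⇒Up {X = X} (within-face-∪⁅⁆ {G} p hG _ p∉G p∈xs xs⊆G∪p) enum =
    inj₂ (X ∩ G , p , downClosed (X ∩ G) G (p∩q⊆q X G) hG , p∉G ∘ p∩q⊆q X G ,
          X⊆G∪⁅p⁆⇒X≡X∩G∪⁅p⁆ (λ {v} → xs⊆G∪p ∘ Equivalence.to (enum v))
                             (Equivalence.from (enum p) p∈xs))

  J⇒Up : J (AddTop H) X → Up H X
  J⇒Up (_ , Fs , _ , inR , strict , transversal , enum) =
    shape⇒Up (transversal-shape (Fs , inR , strict , transversal)) enum

  faces-below : H Y → X ⊆ Y → AddTop H X
  faces-below {Y = Y} {X = X} hY X⊆Y = inj₁ (downClosed X Y X⊆Y hY)

  Up⇒J : Up H X → J (AddTop H) X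
  Up⇒J {X = X} (inj₁ hX) =
    chain⇒J (elements-chain (faces-below hX) ([] , inj₁ hX ∷ [] , single , done))
            (subst (λ xs → Enumerates xs X) (sym (++-identityʳ (elements X)))
                   (elements-enumerates X))
  Up⇒J (inj₂ (I , p , hI , p∉I , refl)) =
    chain⇒J (elements-chain (faces-below hI)
               (⊤ ∷ [] , inj₁ hI ∷ inj₂ refl ∷ [] ,
                step ((λ _ → ∈⊤) , p , ∈⊤ , p∉I) single , pick ∈⊤ p∉I done))
            (enumerates-∪⁅⁆ (elements-enumerates I))

theorem3p1 : (m : ℕ) (H : Family (suc m)) → IsSimplicialComplex H →
    (X : Subset (suc m)) → J (AddTop H) X ⇔ Up H X
theorem3p1 m H complex X = mk⇔ (J⇒Up complex) (Up⇒J complex)
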